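{- The functor $\mathscr{A}_\sigma$ from the category of topological spheres with sphere morphisms to the category of topological $\alpha$-models with $\alpha$-morphisms, defined by $\mathscr{A}_\sigma((S,\tau,\sigma))=(S,\tau,f_\sigma)$ where $f_\sigma(A,x)=A\cap\Sigma(A,x)$, and $\mathscr{A}_\sigma(\varphi)=\varphi$ on morphisms, is an equivalence of categories.
   Context: For a Stone space $(S,\tau)$, $Cl(S)$ is its set of clopens. For $\sigma:S\to\mathcal P(\mathcal P(S))$, $x\in S$, $A\in Cl(S)$, let $\Sigma(A,x)=\bigcap\{U\in\sigma(x):U\cap A\ne\emptyset\}$, where the intersection of the empty family is taken to be $\emptyset$. A topological sphere is $(S,\tau,\sigma)$ with $(S,\tau)$ a Stone space and $\sigma:S\to\mathcal P(\mathcal P(S))$ such that: (S1) each $\sigma(x)$ is nested (any two members comparable under inclusion); (S2) for all $A,B\in Cl(S)$, $\{x\in S:A\cap\Sigma(A,x)\subseteq B\}$ is clopen; (S3) for all $x$, $A\in Cl(S)$, if $A\cap\bigcup\sigma(x)\ne\emptyset$ there is a smallest $U\in\sigma(x)$ with $U\cap A\ne\emptyset$; (S4) $A\cap\Sigma(A,x)$ is closed for all $x$, $A\in Cl(S)$. A sphere morphism $(S,\tau,\sigma)\to(S',\tau',\sigma')$ is a continuous $\varphi:S\to S'$ such that for all $x,y\in S$, $y'\in S'$, $A'\in Cl(S')$: (i) if $\varphi^{ -1}[A']\cap\bigcup\sigma(x)\ne\emptyset$ and $y\in\varphi^{ -1}[A']\cap\Sigma(\varphi^{ -1}[A'],x)$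 then $\varphi(y)\in\Sigma(A',\varphi(x))$; (ii) if $A'\cap\bigcup\sigma'(\varphi(x))\ne\emptyset$ and $y'\in A'\cap\Sigma(A',\varphi(x))$ then there is $y\in S$ with $\varphi(y)=y'$ and $y\in\Sigma(\varphi^{ -1}[A'],x)$. A topological $\alpha$-model is $(S,\tau,f)$ with $(S,\tau)$ a Stone space and $f:Cl(S)\times S\to\mathcal P(S)$ such that for all $A,B\in Cl(S)$, $x\in S$: ($\alpha$1) $f(A,x)\subseteq A$; ($\alpha$2) if $f(A,x)\subseteq B$ and $f(B,x)\subseteq A$ then $f(A,x)=f(B,x)$; ($\alpha$3) $f(A\cup B,x)\subseteq A$ or $f(A\cup B,x)\subseteq B$ or $f(A\cup B,x)=f(A,x)\cup f(B,x)$; ($\alpha$4) $\{x\in S:f(A,x)\subseteq B\}$ is clopen; ($\alpha$5) $f(A,x)$ is closed. An $\alpha$-morphism $(S,\tau,f)\to(S',\tau',f')$ is a continuous $\varphi:S\to S'$ such that for all $x,y\in S$, $y'\in S'$, $A'\in Cl(S')$: $y\in f(\varphi^{ -1}[A'],x)$ implies $\varphi(y)\in f'(A',\varphi(x))$; and $y'\in f'(A',\varphi(x))$ implies there is $y$ with $\varphi(y)=y'$ and $y\in f(\varphi^{ -1}[A'],x)$. -}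

module Defs where

open import Level using (0ℓ)
open import Data.Product using (Σ; ∃; _×_; _,_)
open import Data.Sum using (_⊎_)
open import Data.Empty using (⊥)
open import Data.List using (List)
open import Data.List.Relation.Unary.Any using (Any)
open import Relation.Nullary using (¬_)
open import Relation.Binary.PropositionalEquality using (_≡_)
open import Axiom.ExcludedMiddle using (ExcludedMiddle)

Subset : Set → Set₁
Subset S = S → Set

module _ {S : Set} where

  infix 4 _⊆_ _≐_
  infixr 7 _∩_
  infixr 6 _∪_

  _⊆_ : Subset S → Subset S → Set
  A ⊆ B = ∀ x → A x → B x

  _≐_ : Subset S → Subset S → Set
  A ≐ B = (A ⊆ B) × (B ⊆ A)

  _∩_ : Subset S → Subset S → Subset S
  (A ∩ B) x = A x × B x

  _∪_ : Subset S → Subset S → Subset S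
  (A ∪ B) x = A x ⊎ B x

  ∁ : Subset S → Subset S
  ∁ A x = ¬ A x

  Full : Subset S
  Full x = S

  Empty : Subset S
  Empty x = ⊥

  Meets : Subset S → Subset S → Set
  Meets U A = ∃ λ y → U y × A y


preimage : {S S' : Set} → (S → S') → Subset S' → Subset S
preimage φ A' x = A' (φ x)

record Topology (S : Set) : Set₁ where
  field
    Open       : Subset S → Set
    open-ext   : ∀ {U V} → U ≐ V → Open U → Open V
    open-full  : Open Full
    open-empty : Open Empty
    open-∩     : ∀ {U V} → Open U → Open V → Open (U ∩ V)
    open-⋃     : (I : Set) (U : I → Subset S) → (∀ i → Open (U i)) →
                 Open (λ x → ∃ λ i → U i x)

  Closed : Subset S → Set
  Closed A = Open (∁ A)

  Clopen : Subset S → Set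
  Clopen A = Open A × Closed A

open Topology public

record IsStone {S : Set} (τ : Topology S) : Set₁ where
  field
    compact : (I : Set) (U : I → Subset S) → (∀ i → Open τ (U i)) →
              (∀ x → ∃ λ i → U i x) →
              ∃ λ (is : List I) → ∀ x → Any (λ i → U i x) is
    hausdorff : ∀ x y → ¬ (x ≡ y) →
                ∃ λ U → ∃ λ V → Open τ U × Open τ V × U x × V y ×
                  (∀ z → U z → V z → ⊥)
    zeroDim : ∀ U x → Open τ U → U x →
              ∃ λ C → Clopen τ C × C x × C ⊆ U

Continuous : {S S' : Set} → Topology S → Topology S' → (S → S') → Set₁
Continuous τ τ' φ = ∀ U' → Open τ' U' → Open τ (preimage φ U')

-- σ(x) ⊆ 𝒫(S) is a family of subsets of S, presented (to stay within
-- Set) as an indexed family: σ(x) = { mem x i : i : Idx x }.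
record SphereMap (S : Set) : Set₁ where
  field
    Idx : S → Set
    mem : (x : S) → Idx x → Subset S
open SphereMap public

module _ {S : Set} (σ : SphereMap S) where

  ⋃σ : S → Subset S
  ⋃σ x y = ∃ λ (i : Idx σ x) → mem σ x i y

  -- Σ(A,x) = ⋂ {U ∈ σ(x) : U ∩ A ≠ ∅}, and ∅ if that family is empty
  Σσ : Subset S → S → Subset S
  Σσ A x y = (∃ λ (i : Idx σ x) → Meets (mem σ x i) A) ×
             (∀ (i : Idx σ x) → Meets (mem σ x i) A → mem σ x i y)

  fσ : Subset S → S → Subset S
  fσ A x = A ∩ Σσ A x

record Sphere : Set₂ where
  field
    Carrier : Set
    τ       : Topology Carrier
    stone   : IsStone τ
    σ       : SphereMap Carrier
    S1 : ∀ x (i j : Idx σ x) → mem σ x i ⊆ mem σ x j ⊎ mem σ x j ⊆ mem σ x i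
    S2 : ∀ A B → Clopen τ A → Clopen τ B →
         Clopen τ (λ x → fσ σ A x ⊆ B)
    S3 : ∀ x A → Clopen τ A → Meets A (⋃σ σ x) →
         ∃ λ (i : Idx σ x) → Meets (mem σ x i) A ×
           (∀ (j : Idx σ x) → Meets (mem σ x j) A → mem σ x i ⊆ mem σ x j)
    S4 : ∀ x A → Clopen τ A → Closed τ (fσ σ A x)

SphereMorphism : (T T' : Sphere) → (Sphere.Carrier T → Sphere.Carrier T') → Set₁
SphereMorphism T T' φ =
  Continuous (Sphere.τ T) (Sphere.τ T') φ ×
  (∀ x y A' → Clopen (Sphere.τ T') A' →
     Meets (preimage φ A') (⋃σ (Sphere.σ T) x) →
     fσ (Sphere.σ T) (preimage φ A') x y →
     Σσ (Sphere.σ T') A' (φ x) (φ y)) ×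
  (∀ x y' A' → Clopen (Sphere.τ T') A' →
     Meets A' (⋃σ (Sphere.σ T') (φ x)) →
     fσ (Sphere.σ T') A' (φ x) y' →
     ∃ λ y → φ y ≡ y' × Σσ (Sphere.σ T) (preimage φ A') x y)

record IsAlphaModel {S : Set} (τ : Topology S) (f : Subset S → S → Subset S) : Set₁ where
  field
    -- f is a function of the set A (not of its predicate presentation)
    f-ext : ∀ A B x → Clopen τ A → Clopen τ B → A ≐ B → f A x ≐ f B x
    α1 : ∀ A x → Clopen τ A → f A x ⊆ A
    α2 : ∀ A B x → Clopen τ A → Clopen τ B →
         f A x ⊆ B → f B x ⊆ A → f A x ≐ f B x
    α3 : ∀ A B x → Clopen τ A → Clopen τ B →
         (f (A ∪ B) x ⊆ A) ⊎ (f (A ∪ B) x ⊆ B) ⊎ (f (A ∪ B) x ≐ (f A x ∪ f B x))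
    α4 : ∀ A B → Clopen τ A → Clopen τ B → Clopen τ (λ x → f A x ⊆ B)
    α5 : ∀ A x → Clopen τ A → Closed τ (f A x)

record AlphaModel : Set₂ where
  field
    Carrier : Set
    τ       : Topology Carrier
    stone   : IsStone τ
    f       : Subset Carrier → Carrier → Subset Carrier
    isAlpha : IsAlphaModel τ f

AlphaMorphism : (M M' : AlphaModel) → (AlphaModel.Carrier M → AlphaModel.Carrier M') → Set₁
AlphaMorphism M M' φ =
  Continuous (AlphaModel.τ M) (AlphaModel.τ M') φ ×
  (∀ x y A' → Clopen (AlphaModel.τ M') A' →
     AlphaModel.f M (preimage φ A') x y → AlphaModel.f M' A' (φ x) (φ y)) ×
  (∀ x y' A' → Clopen (AlphaModel.τ M') A' →
     AlphaModel.f M' A' (φ x) y' →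
     ∃ λ y → φ y ≡ y' × AlphaModel.f M (preimage φ A') x y)

AlphaIso : AlphaModel → AlphaModel → Set₁
AlphaIso M M' =
  Σ (AlphaModel.Carrier M → AlphaModel.Carrier M') λ φ →
  Σ (AlphaModel.Carrier M' → AlphaModel.Carrier M) λ ψ →
    AlphaMorphism M M' φ × AlphaMorphism M' M ψ ×
    (∀ x → ψ (φ x) ≡ x) × (∀ y → φ (ψ y) ≡ y)

module _ where
  open Sphere

  -- object part (its α-model axioms are part of the theorem, so we
  -- package the data and require the axioms as a proof)
  𝒜σ-obj : (T : Sphere) → IsAlphaModel (τ T) (fσ (σ T)) → AlphaModel
  𝒜σ-obj T p = record { Carrier = Carrier T ; τ = τ T ; stone = stone T
                      ; f = fσ (σ T) ; isAlpha = p }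

-- 𝒜σ is an equivalence of categories: it is well defined (a functor),
-- faithful (automatic: identity on underlying maps), full, and
-- essentially surjective.
IsEquivalence𝒜σ : Set₂
IsEquivalence𝒜σ =
  Σ ((T : Sphere) → IsAlphaModel (Sphere.τ T) (fσ (Sphere.σ T))) λ wd →
    (∀ T T' φ → SphereMorphism T T' φ →
       AlphaMorphism (𝒜σ-obj T (wd T)) (𝒜σ-obj T' (wd T')) φ) ×
    (∀ T T' φ → AlphaMorphism (𝒜σ-obj T (wd T)) (𝒜σ-obj T' (wd T')) φ →
       SphereMorphism T T' φ) ×
    (∀ (M : AlphaModel) → ∃ λ (T : Sphere) → AlphaIso (𝒜σ-obj T (wd T)) M)

{-# OPTIONS --safe #-}
module Submission where

-- A sphere system gives an α-model: f_σ(A,x) = A ∩ U for the least sphere U meeting A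
-- (S3), whence α2; and once Σ(A ∪ B,x) meets A it coincides with Σ(A,x), whence α3.
-- Conversely, fix x in an α-model and write f(A) for f(A,x). Axioms α2 and α3 give
-- Arrow's condition f(A) = f(D) ∩ A whenever A ⊆ D and f(D) meets A. With it,
-- "C ⊑ A iff f(A ∪ C) meets C" is a total preorder on the clopens with f(A) ≠ ∅, and
-- the sets U_A = ⋃ {f(C) : C ⊑ A} are nested spheres; U_A is the least one meeting A,
-- and A ∩ U_A = f(A). So every α-model is f_σ for spheres on the same Stone space, and
-- the identity is an isomorphism. Morphisms match because the extra hypothesis of a
-- sphere morphism holds as soon as Σ(A,x) is inhabited.

open import Defs
open import Level using (0ℓ)
open import Axiom.ExcludedMiddle using (ExcludedMiddle)
open import Data.Bool using (Bool; true; false; T)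
open import Data.Empty using (⊥-elim)
open import Data.Product using (Σ; ∃; _×_; _,_; proj₁; proj₂; map₂)
open import Data.Sum as Sum using (_⊎_; inj₁; inj₂; [_,_])
open import Function using (_∘_; id; it)
open import Relation.Nullary using (yes; no)
open import Relation.Nullary.Decidable using (isYes; toWitness; fromWitness; decidable-stable)
open import Relation.Binary.PropositionalEquality using (_≡_; refl; sym; subst)

module _ {S : Set} where

  ⊆-refl : {A : Subset S} → A ⊆ A
  ⊆-refl _ a = a

  ⊆-trans : {A B C : Subset S} → A ⊆ B → B ⊆ C → A ⊆ C
  ⊆-trans A⊆B B⊆C x = B⊆C x ∘ A⊆B x

  ≐-sym : {A B : Subset S} → A ≐ B → B ≐ A
  ≐-sym (A⊆B , B⊆A) = B⊆A , A⊆B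

  ≐-trans : {A B C : Subset S} → A ≐ B → B ≐ C → A ≐ C
  ≐-trans (A⊆B , B⊆A) (B⊆C , C⊆B) = ⊆-trans A⊆B B⊆C , ⊆-trans C⊆B B⊆A

  ⊆-∪ˡ : {A B : Subset S} → A ⊆ A ∪ B
  ⊆-∪ˡ _ = inj₁

  ⊆-∪ʳ : {A B : Subset S} → B ⊆ A ∪ B
  ⊆-∪ʳ _ = inj₂

  ∪-comm : {A B : Subset S} → A ∪ B ≐ B ∪ A
  ∪-comm = (λ _ → [ inj₂ , inj₁ ]) , (λ _ → [ inj₂ , inj₁ ])

  ∪-congʳ : {A A′ C : Subset S} → A ≐ A′ → A ∪ C ≐ A′ ∪ C
  ∪-congʳ (A⊆A′ , A′⊆A) = (λ x → [ inj₁ ∘ A⊆A′ x , inj₂ ]) , (λ x → [ inj₁ ∘ A′⊆A x , inj₂ ])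

  ∁-antitone : {A B : Subset S} → A ⊆ B → ∁ B ⊆ ∁ A
  ∁-antitone A⊆B x ¬b = ¬b ∘ A⊆B x

  ∁-cong : {A B : Subset S} → A ≐ B → ∁ A ≐ ∁ B
  ∁-cong (A⊆B , B⊆A) = ∁-antitone B⊆A , ∁-antitone A⊆B

  ∁∪∁⊆∁∩ : {A B : Subset S} → ∁ A ∪ ∁ B ⊆ ∁ (A ∩ B)
  ∁∪∁⊆∁∩ _ (inj₁ ¬a) (a , _) = ¬a a
  ∁∪∁⊆∁∩ _ (inj₂ ¬b) (_ , b) = ¬b b

  ∁∩∁≐∁∪ : {A B : Subset S} → ∁ A ∩ ∁ B ≐ ∁ (A ∪ B)
  ∁∩∁≐∁∪ = (λ _ (¬a , ¬b) → [ ¬a , ¬b ]) , (λ _ ¬a∪b → ¬a∪b ∘ inj₁ , ¬a∪b ∘ inj₂)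

  Meets-monoʳ : {U A B : Subset S} → A ⊆ B → Meets U A → Meets U B
  Meets-monoʳ A⊆B (y , u , a) = y , u , A⊆B y a

  Meets⇒nonempty : {U A : Subset S} → Meets U A → ∃ U
  Meets⇒nonempty (y , u , _) = y , u

module _ {S : Set} (τ : Topology S) where

  open-∪ : {A B : Subset S} → Open τ A → Open τ B → Open τ (A ∪ B)
  open-∪ {A} {B} oA oB = open-ext τ (⋃U⊆A∪B , A∪B⊆⋃U) (open-⋃ τ Bool U U-open)
    where
      U : Bool → Subset S
      U true = A
      U false = B
      U-open : ∀ b → Open τ (U b)
      U-open true = oA
      U-open false = oB
      ⋃U⊆A∪B : (λ x → ∃ λ b → U b x) ⊆ A ∪ B
      ⋃U⊆A∪B _ (true , a) = inj₁ a
      ⋃U⊆A∪B _ (false , b) = inj₂ b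
      A∪B⊆⋃U : A ∪ B ⊆ (λ x → ∃ λ b → U b x)
      A∪B⊆⋃U _ = [ (true ,_) , (false ,_) ]

  closed-resp-≐ : {A B : Subset S} → A ≐ B → Closed τ A → Closed τ B
  closed-resp-≐ A≐B = open-ext τ (∁-cong A≐B)

  clopen-resp-≐ : {A B : Subset S} → A ≐ B → Clopen τ A → Clopen τ B
  clopen-resp-≐ A≐B (oA , cA) = open-ext τ A≐B oA , closed-resp-≐ A≐B cA

module Classical (lem : ExcludedMiddle 0ℓ) where

  module _ {S : Set} where

    ∁∁⊆ : {A : Subset S} → ∁ (∁ A) ⊆ A
    ∁∁⊆ _ = decidable-stable lem

    ∁∩⊆∁∪∁ : {A B : Subset S} → ∁ (A ∩ B) ⊆ ∁ A ∪ ∁ B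
    ∁∩⊆∁∪∁ {A} x ¬a∩b with lem {A x}
    ... | yes a = inj₂ (λ b → ¬a∩b (a , b))
    ... | no ¬a = inj₁ ¬a

    ∪-diff≐ : {A D : Subset S} → A ⊆ D → A ∪ (D ∩ ∁ A) ≐ D
    ∪-diff≐ {A} {D} A⊆D = (λ x → [ A⊆D x , proj₁ ]) , split
      where
        split : D ⊆ A ∪ (D ∩ ∁ A)
        split x d with lem {A x}
        ... | yes a = inj₁ a
        ... | no ¬a = inj₂ (d , ¬a)

  module ClopenInstances {S : Set} (τ : Topology S) where

    instance
      clopen-∪ : {A B : Subset S} → {{Clopen τ A}} → {{Clopen τ B}} → Clopen τ (A ∪ B)
      clopen-∪ {{oA , cA}} {{oB , cB}} =
        open-∪ τ oA oB , open-ext τ ∁∩∁≐∁∪ (open-∩ τ cA cB)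

      clopen-∁ : {A : Subset S} → {{Clopen τ A}} → Clopen τ (∁ A)
      clopen-∁ {{oA , cA}} = cA , open-ext τ ((λ _ a ¬a → ¬a a) , ∁∁⊆) oA

      clopen-∩ : {A B : Subset S} → {{Clopen τ A}} → {{Clopen τ B}} → Clopen τ (A ∩ B)
      clopen-∩ {{oA , cA}} {{oB , cB}} =
        open-∩ τ oA oB , open-ext τ (∁∪∁⊆∁∩ , ∁∩⊆∁∪∁) (open-∪ τ cA cB)

module _ {S : Set} (σ : SphereMap S) where

  IsLeastMeeting : (x : S) → Subset S → Idx σ x → Set
  IsLeastMeeting x A i =
    Meets (mem σ x i) A × (∀ j → Meets (mem σ x j) A → mem σ x i ⊆ mem σ x j)

  Σσ⇒meets-⋃σ : {A : Subset S} {x y : S} → Σσ σ A x y → Meets A (⋃σ σ x)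
  Σσ⇒meets-⋃σ ((i , z , z∈U , z∈A) , _) = z , z∈A , i , z∈U

  Σσ-least : {A : Subset S} {x : S} {i : Idx σ x} → IsLeastMeeting x A i → Σσ σ A x ≐ mem σ x i
  Σσ-least {i = i} (meets , least) =
    (λ y y∈Σ → proj₂ y∈Σ i meets) , (λ y y∈U → (i , meets) , λ j m → least j m y y∈U)

  -- If Σ(D,x) has a point in A, every sphere meeting D meets A.
  Σσ-restrict : {A D : Subset S} {x : S} → A ⊆ D → Meets (Σσ σ D x) A → Σσ σ D x ≐ Σσ σ A x
  Σσ-restrict {A} {D} {x} A⊆D (w , w∈ΣD , w∈A) = ΣD⊆ΣA , ΣA⊆ΣD
    where
      meets-A : ∀ i → Meets (mem σ x i) D → Meets (mem σ x i) A
      meets-A i m = w , proj₂ w∈ΣD i m , w∈A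
      ΣD⊆ΣA : Σσ σ D x ⊆ Σσ σ A x
      ΣD⊆ΣA y ((i , m) , y∈all) = (i , meets-A i m) , λ j → y∈all j ∘ Meets-monoʳ A⊆D
      ΣA⊆ΣD : Σσ σ A x ⊆ Σσ σ D x
      ΣA⊆ΣD y ((i , m) , y∈all) = (i , Meets-monoʳ A⊆D m) , λ j → y∈all j ∘ meets-A j

  fσ-resp-≐ : {A B : Subset S} {x : S} → A ≐ B → fσ σ A x ≐ fσ σ B x
  fσ-resp-≐ {x = x} A≐B = fσ-⊆ A≐B , fσ-⊆ (≐-sym A≐B)
    where
      fσ-⊆ : {A B : Subset S} → A ≐ B → fσ σ A x ⊆ fσ σ B x
      fσ-⊆ (A⊆B , B⊆A) y (a , (i , m) , y∈all) =
        A⊆B y a , (i , Meets-monoʳ A⊆B m) , λ j → y∈all j ∘ Meets-monoʳ B⊆A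

  fσ-α3 : ExcludedMiddle 0ℓ → (A B : Subset S) (x : S) →
          (fσ σ (A ∪ B) x ⊆ A) ⊎ (fσ σ (A ∪ B) x ⊆ B) ⊎ (fσ σ (A ∪ B) x ≐ (fσ σ A x ∪ fσ σ B x))
  fσ-α3 lem A B x with lem {Meets (Σσ σ (A ∪ B) x) A} | lem {Meets (Σσ σ (A ∪ B) x) B}
  ... | no ¬mA | _ =
    inj₂ (inj₁ λ { y (inj₁ a , y∈Σ) → ⊥-elim (¬mA (y , y∈Σ , a)) ; y (inj₂ b , _) → b })
  ... | yes _ | no ¬mB =
    inj₁ λ { y (inj₁ a , _) → a ; y (inj₂ b , y∈Σ) → ⊥-elim (¬mB (y , y∈Σ , b)) }
  ... | yes mA | yes mB = inj₂ (inj₂ (to , from))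
    where
      ΣA = Σσ-restrict ⊆-∪ˡ mA
      ΣB = Σσ-restrict ⊆-∪ʳ mB
      to : fσ σ (A ∪ B) x ⊆ fσ σ A x ∪ fσ σ B x
      to y (inj₁ a , y∈Σ) = inj₁ (a , proj₁ ΣA y y∈Σ)
      to y (inj₂ b , y∈Σ) = inj₂ (b , proj₁ ΣB y y∈Σ)
      from : fσ σ A x ∪ fσ σ B x ⊆ fσ σ (A ∪ B) x
      from y (inj₁ (a , y∈Σ)) = inj₁ a , proj₂ ΣA y y∈Σ
      from y (inj₂ (b , y∈Σ)) = inj₂ b , proj₂ ΣB y y∈Σ

module _ (T : Sphere) where
  open Sphere T

  -- The least sphere U_j meeting B meets A, since its B-points lie in f_σ(B,x) ⊆ A;
  -- so the points of Σ(A,x) lie in U_j.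
  fσ-α2-⊆ : ∀ {A B x} → Clopen τ B → fσ σ A x ⊆ B → fσ σ B x ⊆ A → fσ σ A x ⊆ fσ σ B x
  fσ-α2-⊆ {A} {B} {x} cB fA⊆B fB⊆A y y∈fA@(_ , (i , mi) , y∈ΣA)
    with S3 x B cB (y , fA⊆B y y∈fA , i , y∈ΣA i mi)
  ... | j , least@((w , w∈Uj , w∈B) , _) =
    fA⊆B y y∈fA , Uj⊆ΣB y (y∈ΣA j (w , w∈Uj , fB⊆A w (w∈B , Uj⊆ΣB w w∈Uj)))
    where
      Uj⊆ΣB = proj₂ (Σσ-least σ least)

  fσ-isAlphaModel : ExcludedMiddle 0ℓ → IsAlphaModel τ (fσ σ)
  fσ-isAlphaModel lem = record
    { f-ext = λ A B x _ _ → fσ-resp-≐ σ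
    ; α1 = λ A x _ _ → proj₁
    ; α2 = λ A B x cA cB fA⊆B fB⊆A → fσ-α2-⊆ cB fA⊆B fB⊆A , fσ-α2-⊆ cA fB⊆A fA⊆B
    ; α3 = λ A B x _ _ → fσ-α3 σ lem A B x
    ; α4 = S2
    ; α5 = λ A x cA → S4 x A cA
    }

module _ (T T′ : Sphere) where
  open Sphere

  sphereMorphism⇒alphaMorphism :
    ∀ p p′ φ → SphereMorphism T T′ φ → AlphaMorphism (𝒜σ-obj T p) (𝒜σ-obj T′ p′) φ
  sphereMorphism⇒alphaMorphism _ _ φ (continuous , forth , back) = continuous , forth′ , back′
    where
      forth′ : ∀ x y A′ → Clopen (τ T′) A′ →
               fσ (σ T) (preimage φ A′) x y → fσ (σ T′) A′ (φ x) (φ y)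
      forth′ x y A′ cA′ y∈f@(φy∈A′ , y∈Σ) =
        φy∈A′ , forth x y A′ cA′ (Σσ⇒meets-⋃σ (σ T) y∈Σ) y∈f
      back′ : ∀ x y′ A′ → Clopen (τ T′) A′ → fσ (σ T′) A′ (φ x) y′ →
              ∃ λ y → φ y ≡ y′ × fσ (σ T) (preimage φ A′) x y
      back′ x y′ A′ cA′ y′∈f@(y′∈A′ , y′∈Σ) with back x y′ A′ cA′ (Σσ⇒meets-⋃σ (σ T′) y′∈Σ) y′∈f
      ... | y , φy≡y′ , y∈Σ = y , φy≡y′ , subst A′ (sym φy≡y′) y′∈A′ , y∈Σ

  alphaMorphism⇒sphereMorphism :
    ∀ p p′ φ → AlphaMorphism (𝒜σ-obj T p) (𝒜σ-obj T′ p′) φ → SphereMorphism T T′ φ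
  alphaMorphism⇒sphereMorphism _ _ φ (continuous , forth , back) =
    continuous ,
    (λ x y A′ cA′ _ y∈f → proj₂ (forth x y A′ cA′ y∈f)) ,
    (λ x y′ A′ cA′ _ → map₂ (map₂ proj₂) ∘ back x y′ A′ cA′)

module _ {S : Set} {τ : Topology S} {stone : IsStone τ} where

  alphaModel : (f : Subset S → S → Subset S) → IsAlphaModel τ f → AlphaModel
  alphaModel f p = record { Carrier = S ; τ = τ ; stone = stone ; f = f ; isAlpha = p }

  id-alphaMorphism : ∀ {f g p q} → (∀ A x → Clopen τ A → f A x ≐ g A x) →
                     AlphaMorphism (alphaModel f p) (alphaModel g q) id
  id-alphaMorphism f≐g =
    (λ _ → id) ,
    (λ x y A cA → proj₁ (f≐g A x cA) y) ,
    (λ x y A cA y∈g → y , refl , proj₂ (f≐g A x cA) y y∈g)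

  ≐-alphaIso : ∀ {f g p q} → (∀ A x → Clopen τ A → f A x ≐ g A x) →
               AlphaIso (alphaModel f p) (alphaModel g q)
  ≐-alphaIso {p = p} {q} f≐g =
    id , id ,
    id-alphaMorphism {p = p} {q} f≐g , id-alphaMorphism {p = q} {p} (λ A x → ≐-sym ∘ f≐g A x) ,
    (λ _ → refl) , (λ _ → refl)

module AlphaModelIsSphere (lem : ExcludedMiddle 0ℓ) (M : AlphaModel) where
  open AlphaModel M renaming (Carrier to S)
  open IsAlphaModel isAlpha
  open Classical lem
  open ClopenInstances τ

  -- σ(x) must be indexed by a type in Set, while Subset S lives in Set₁, so clopen
  -- sets are coded by their characteristic functions (which exist by excluded middle).
  record ClopenCode : Set where
    field
      χ : S → Bool
      χ-clopen : Clopen τ (T ∘ χ)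
  open ClopenCode

  -- A data type rather than T ∘ χ c, so that ⟦_⟧ is injective and instance search
  -- finds Clopen τ ⟦ c ⟧.
  data ⟦_⟧ (c : ClopenCode) (z : S) : Set where
    ⟨_⟩ : T (χ c z) → ⟦ c ⟧ z

  instance
    ⟦⟧-clopen : {c : ClopenCode} → Clopen τ ⟦ c ⟧
    ⟦⟧-clopen {c} = clopen-resp-≐ τ ((λ _ → ⟨_⟩) , (λ { _ ⟨ t ⟩ → t })) (χ-clopen c)

  code : (A : Subset S) → {{Clopen τ A}} → ClopenCode
  code A {{cA}} = record
    { χ = λ z → isYes (lem {A z})
    ; χ-clopen = clopen-resp-≐ τ ((λ _ → fromWitness) , (λ _ → toWitness)) cA
    }

  ⟦code⟧ : {A : Subset S} → {{_ : Clopen τ A}} → ⟦ code A ⟧ ≐ A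
  ⟦code⟧ = (λ { _ ⟨ t ⟩ → toWitness t }) , (λ _ a → ⟨ fromWitness a ⟩)

  variable
    A A′ B C D : Subset S

  module Plausibility (x : S) where

    F : Subset S → Subset S
    F A = f A x

    F-⊆ : {{Clopen τ A}} → F A ⊆ A
    F-⊆ {{cA}} = α1 _ x cA

    F-resp-≐ : {{Clopen τ A}} → {{Clopen τ B}} → A ≐ B → F A ≐ F B
    F-resp-≐ {{cA}} {{cB}} = f-ext _ _ x cA cB

    F-nonempty-mono : {{Clopen τ A}} → {{Clopen τ D}} → A ⊆ D → ∃ (F A) → ∃ (F D)
    F-nonempty-mono {{cA}} {{cD}} A⊆D (w , w∈FA) = decidable-stable lem λ FD-empty →
      let FA≐FD = α2 _ _ x cA cD (⊆-trans F-⊆ A⊆D) (λ y y∈FD → ⊥-elim (FD-empty (y , y∈FD)))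
      in FD-empty (w , proj₁ FA≐FD w w∈FA)

    F-split : {{Clopen τ A}} → {{Clopen τ D}} → A ⊆ D →
              (F D ⊆ A) ⊎ (F D ⊆ D ∩ ∁ A) ⊎ (F D ≐ F A ∪ F (D ∩ ∁ A))
    F-split {A} {D} {{cA}} A⊆D =
      Sum.map (⊆-trans FD⊆)
              (Sum.map (⊆-trans FD⊆) λ (to , from) → ⊆-trans FD⊆ to , ⊆-trans from ⊆FD)
              (α3 A (D ∩ ∁ A) x cA it)
      where
        FD⊆ = proj₂ (F-resp-≐ (∪-diff≐ A⊆D))
        ⊆FD = proj₁ (F-resp-≐ (∪-diff≐ A⊆D))

    F-restrict : {{Clopen τ A}} → {{Clopen τ D}} → A ⊆ D → Meets (F D) A → F A ≐ F D ∩ A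
    F-restrict {A} {D} {{cA}} {{cD}} A⊆D (w , w∈FD , w∈A) with F-split A⊆D
    ... | inj₁ FD⊆A =
      let FA≐FD = α2 A D x cA cD (⊆-trans F-⊆ A⊆D) FD⊆A
      in (λ y y∈FA → proj₁ FA≐FD y y∈FA , F-⊆ y y∈FA) , (λ y → proj₂ FA≐FD y ∘ proj₁)
    ... | inj₂ (inj₁ FD⊆D∖A) = ⊥-elim (proj₂ (FD⊆D∖A w w∈FD) w∈A)
    ... | inj₂ (inj₂ (FD⊆ , ⊆FD)) =
      (λ y y∈FA → ⊆FD y (inj₁ y∈FA) , F-⊆ y y∈FA) ,
      (λ { y (y∈FD , y∈A) → [ id , (λ y∈FE → ⊥-elim (proj₂ (F-⊆ y y∈FE) y∈A)) ] (FD⊆ y y∈FD) })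

    F-meets-restrict : {{Clopen τ A}} → {{Clopen τ D}} →
                       A ⊆ D → C ⊆ A → Meets (F D) C → Meets (F A) C
    F-meets-restrict A⊆D C⊆A (y , y∈FD , y∈C) =
      y , proj₂ (F-restrict A⊆D (y , y∈FD , C⊆A y y∈C)) y (y∈FD , C⊆A y y∈C) , y∈C

    F-meets-extend : {{Clopen τ A}} → {{Clopen τ D}} →
                     A ⊆ D → Meets (F D) A → Meets (F A) C → Meets (F D) C
    F-meets-extend A⊆D FD-meets-A (y , y∈FA , y∈C) =
      y , proj₁ (proj₁ (F-restrict A⊆D FD-meets-A) y y∈FA) , y∈C

    -- C ⊑ A: C is at least as plausible as A.
    infix 4 _⊑_
    _⊑_ : Subset S → Subset S → Set
    C ⊑ A = Meets (F (A ∪ C)) C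

    ⊑-total : {{Clopen τ A}} → {{Clopen τ C}} → ∃ (F A) → A ⊑ C ⊎ C ⊑ A
    ⊑-total {A} {C} FA-nonempty with F-nonempty-mono {D = A ∪ C} ⊆-∪ˡ FA-nonempty
    ... | w , w∈F with F-⊆ w w∈F
    ... | inj₁ w∈A = inj₁ (w , proj₁ (F-resp-≐ ∪-comm) w w∈F , w∈A)
    ... | inj₂ w∈C = inj₂ (w , w∈F , w∈C)

    -- A point of f((A ∪ B) ∪ C) in B, A or C is passed on along B → A → C by restriction.
    ⊑-trans : {{Clopen τ A}} → {{Clopen τ B}} → {{Clopen τ C}} → C ⊑ A → A ⊑ B → C ⊑ B
    ⊑-trans {A} {B} {C} C⊑A A⊑B = from-D (F-nonempty-mono A∪C⊆D (Meets⇒nonempty C⊑A))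
      where
        A∪C⊆D : A ∪ C ⊆ (A ∪ B) ∪ C
        A∪C⊆D _ = [ inj₁ ∘ inj₁ , inj₂ ]
        from-C : Meets (F ((A ∪ B) ∪ C)) C → C ⊑ B
        from-C = F-meets-restrict (λ _ → [ inj₁ ∘ inj₂ , inj₂ ]) ⊆-∪ʳ
        from-A : Meets (F ((A ∪ B) ∪ C)) A → C ⊑ B
        from-A m = from-C (F-meets-extend A∪C⊆D (Meets-monoʳ ⊆-∪ˡ m) C⊑A)
        from-B : Meets (F ((A ∪ B) ∪ C)) B → C ⊑ B
        from-B m =
          from-A (F-meets-extend (λ _ → [ inj₁ ∘ inj₂ , inj₁ ∘ inj₁ ]) (Meets-monoʳ ⊆-∪ˡ m) A⊑B)
        from-D : ∃ (F ((A ∪ B) ∪ C)) → C ⊑ B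
        from-D (w , w∈FD) with F-⊆ w w∈FD
        ... | inj₁ (inj₁ w∈A) = from-A (w , w∈FD , w∈A)
        ... | inj₁ (inj₂ w∈B) = from-B (w , w∈FD , w∈B)
        ... | inj₂ w∈C = from-C (w , w∈FD , w∈C)

    F-meets⇒⊑ : {{Clopen τ B}} → {{Clopen τ C}} → Meets (F C) B → B ⊑ C
    F-meets⇒⊑ {B} {C} FC-meets-B with F-nonempty-mono {D = C ∪ B} ⊆-∪ˡ (Meets⇒nonempty FC-meets-B)
    ... | w , w∈F with F-⊆ w w∈F
    ... | inj₁ w∈C = F-meets-extend ⊆-∪ˡ (w , w∈F , w∈C) FC-meets-B
    ... | inj₂ w∈B = w , w∈F , w∈B

    ⊑-nonempty : {{Clopen τ B}} → {{Clopen τ C}} → B ⊑ C → ∃ (F B)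
    ⊑-nonempty B⊑C = Meets⇒nonempty (F-meets-restrict ⊆-∪ʳ ⊆-refl B⊑C)

    F-∩-⊑ : {{Clopen τ B}} → {{Clopen τ C}} → C ⊑ B → F C ∩ B ⊆ F B
    F-∩-⊑ C⊑B z (z∈FC , z∈B) = proj₂ (F-restrict ⊆-∪ˡ (z , z∈FB∪C , z∈B)) z (z∈FB∪C , z∈B)
      where
        z∈FB∪C = proj₁ (proj₁ (F-restrict ⊆-∪ʳ C⊑B) z z∈FC)

    ⊑-respʳ-≐ : {{Clopen τ A}} → {{Clopen τ A′}} → {{Clopen τ C}} → A ≐ A′ → C ⊑ A → C ⊑ A′
    ⊑-respʳ-≐ A≐A′ (w , w∈F , w∈C) = w , proj₁ (F-resp-≐ (∪-congʳ A≐A′)) w w∈F , w∈C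

    sphere : Subset S → Subset S
    sphere A z = ∃ λ c → F ⟦ c ⟧ z × ⟦ c ⟧ ⊑ A

    sphere-mono : {{Clopen τ A}} → {{Clopen τ B}} → A ⊑ B → sphere A ⊆ sphere B
    sphere-mono A⊑B z (c , z∈Fc , c⊑A) = c , z∈Fc , ⊑-trans c⊑A A⊑B

    sphere-resp-≐ : {{Clopen τ A}} → {{Clopen τ A′}} → A ≐ A′ → sphere A ⊆ sphere A′
    sphere-resp-≐ A≐A′ z (c , z∈Fc , c⊑A) = c , z∈Fc , ⊑-respʳ-≐ A≐A′ c⊑A

    F⊆sphere : {{Clopen τ A}} → F A ⊆ sphere A
    F⊆sphere {A} z z∈FA =
      code A , proj₂ (F-resp-≐ ⟦code⟧) z z∈FA , F-meets⇒⊑ (z , z∈FA , proj₂ ⟦code⟧ z (F-⊆ z z∈FA))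

    ∩-sphere⊆F : {{Clopen τ A}} → A ∩ sphere A ⊆ F A
    ∩-sphere⊆F z (z∈A , c , z∈Fc , c⊑A) = F-∩-⊑ c⊑A z (z∈Fc , z∈A)

    sphere-meets⇒⊑ : {{Clopen τ A}} → {{Clopen τ B}} → Meets (sphere A) B → B ⊑ A
    sphere-meets⇒⊑ (z , (c , z∈Fc , c⊑A) , z∈B) = ⊑-trans (F-meets⇒⊑ (z , z∈Fc , z∈B)) c⊑A

  open Plausibility using (F; F-⊆; F-resp-≐; ⊑-total; sphere; sphere-mono; sphere-resp-≐;
                           F⊆sphere; ∩-sphere⊆F; sphere-meets⇒⊑; ⊑-nonempty)

  plausibilitySpheres : SphereMap S
  plausibilitySpheres = record
    { Idx = λ x → Σ ClopenCode λ c → ∃ (F x ⟦ c ⟧)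
    ; mem = λ x i → sphere x ⟦ proj₁ i ⟧
    }

  module _ {x : S} where

    sphere-index : (A : Subset S) → {{Clopen τ A}} → ∃ (F x A) → Idx plausibilitySpheres x
    sphere-index A (w , w∈FA) = code A , w , proj₂ (F-resp-≐ x {A = ⟦ code A ⟧} ⟦code⟧) w w∈FA

    mem-sphere-index : {{_ : Clopen τ A}} (ne : ∃ (F x A)) →
                       mem plausibilitySpheres x (sphere-index A ne) ≐ sphere x A
    mem-sphere-index _ = sphere-resp-≐ x ⟦code⟧ , sphere-resp-≐ x (≐-sym ⟦code⟧)

    sphere-index-least : {{_ : Clopen τ A}} (ne : ∃ (F x A)) →
                         IsLeastMeeting plausibilitySpheres x A (sphere-index A ne)
    sphere-index-least ne@(w , w∈FA) =
      (w , proj₂ (mem-sphere-index ne) w (F⊆sphere x w w∈FA) , F-⊆ x w w∈FA) ,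
      λ j Uj-meets-A →
        ⊆-trans (proj₁ (mem-sphere-index ne)) (sphere-mono x (sphere-meets⇒⊑ x Uj-meets-A))

    meets-⋃σ⇒F-nonempty : {{Clopen τ A}} → Meets A (⋃σ plausibilitySpheres x) → ∃ (F x A)
    meets-⋃σ⇒F-nonempty (z , z∈A , _ , z∈U) = ⊑-nonempty x (sphere-meets⇒⊑ x (z , z∈U , z∈A))

    Σσ≐sphere : {{_ : Clopen τ A}} → ∃ (F x A) → Σσ plausibilitySpheres A x ≐ sphere x A
    Σσ≐sphere {A} ne =
      ≐-trans (Σσ-least plausibilitySpheres {i = sphere-index A ne} (sphere-index-least ne))
              (mem-sphere-index {A = A} ne)

    fσ≐f : {{Clopen τ A}} → fσ plausibilitySpheres A x ≐ f A x
    fσ≐f {A} =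
      (λ y (y∈A , y∈Σ) → ∩-sphere⊆F x y (y∈A , proj₁ (Σσ≐sphere {A = A} (nonempty y∈Σ)) y y∈Σ)) ,
      (λ y y∈FA → F-⊆ x y y∈FA , proj₂ (Σσ≐sphere {A = A} (y , y∈FA)) y (F⊆sphere x y y∈FA))
      where
        nonempty : ∀ {y} → Σσ plausibilitySpheres A x y → ∃ (F x A)
        nonempty = meets-⋃σ⇒F-nonempty ∘ Σσ⇒meets-⋃σ plausibilitySpheres

  plausibilitySpheres-nested : ∀ x (i j : Idx plausibilitySpheres x) →
                               mem plausibilitySpheres x i ⊆ mem plausibilitySpheres x j ⊎
                               mem plausibilitySpheres x j ⊆ mem plausibilitySpheres x i
  plausibilitySpheres-nested x (c , FAc-nonempty) (d , _) =
    Sum.map (sphere-mono x) (sphere-mono x) (⊑-total x {A = ⟦ c ⟧} {C = ⟦ d ⟧} FAc-nonempty)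

  alphaModel⇒sphere : Sphere
  alphaModel⇒sphere = record
    { Carrier = S
    ; τ = τ
    ; stone = stone
    ; σ = plausibilitySpheres
    ; S1 = plausibilitySpheres-nested
    ; S2 = λ A B cA cB → clopen-resp-≐ τ
             ((λ x → ⊆-trans (proj₁ (fσ≐f {{cA}}))) , (λ x → ⊆-trans (proj₂ (fσ≐f {{cA}}))))
             (α4 A B cA cB)
    ; S3 = λ x A cA meets → let ne = meets-⋃σ⇒F-nonempty {{cA}} meets
                            in sphere-index A {{cA}} ne , sphere-index-least {{cA}} ne
    ; S4 = λ x A cA → closed-resp-≐ τ (≐-sym (fσ≐f {{cA}})) (α5 A x cA)
    }

  𝒜σ-alphaModel⇒sphere≅ : ∀ p → AlphaIso (𝒜σ-obj alphaModel⇒sphere p) M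
  𝒜σ-alphaModel⇒sphere≅ p =
    ≐-alphaIso {stone = stone} {p = p} {isAlpha} (λ A x cA → fσ≐f {x} {A} {{cA}})

theorem5p27 : ExcludedMiddle 0ℓ → IsEquivalence𝒜σ
theorem5p27 lem =
  wd ,
  (λ T T′ → sphereMorphism⇒alphaMorphism T T′ (wd T) (wd T′)) ,
  (λ T T′ → alphaMorphism⇒sphereMorphism T T′ (wd T) (wd T′)) ,
  (λ M → let T = alphaModel⇒sphere lem M in T , 𝒜σ-alphaModel⇒sphere≅ lem M (wd T))
  where
    open AlphaModelIsSphere using (alphaModel⇒sphere; 𝒜σ-alphaModel⇒sphere≅)
    wd : (T : Sphere) → IsAlphaModel (Sphere.τ T) (fσ (Sphere.σ T))
    wd T = fσ-isAlphaModel T lem
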